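{- Let $G$ be a directed graph with vertex set $V$, viewed as the bipartite graph $(V_1,V_2,E)$ described below. Let $(S^*,T^*)$ be a directed densest subgraph, $D=\rho(S^*,T^*)$ and $z=\sqrt{|S^*|/|T^*|}$. Then there exists an induced subgraph $H$ on vertex sets $(S,T)$, $S\subseteq V_1$, $T\subseteq V_2$, such that $d_H(v)\ge D/(2z)$ for all $v\in S$ and $d_H(v)\ge Dz/2$ for all $v\in T$.
   Context: A directed graph $G=(V,E_{\mathrm{dir}})$ is represented as a bipartite graph $(V_1,V_2,E)$ where $V_1,V_2$ are two copies of $V$ and $u\in V_1$, $v\in V_2$ are adjacent iff $(u,v)$ is a directed edge. For nonempty $S\subseteq V_1$, $T\subseteq V_2$, $E(S,T)$ denotes the edges between $S$ and $T$, and $\rho(S,T)=|E(S,T)|/\sqrt{|S||T|}$. A directed densest subgraph is a pair $(S^*,T^*)$ maximizing $\rho$. For the subgraph $H$ induced on $S\cup T$, $d_H(v)$ is the degree of $v$ in $H$. -}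

module Defs where

open import Data.Nat using (ℕ; _+_; _*_; _≤_)
open import Data.Bool using (Bool; true; false; _∧_; if_then_else_)
open import Data.Fin using (Fin)
open import Data.Fin.Subset using (Subset; ∣_∣; Nonempty; _∈_)
open import Data.List using (map; allFin)
open import Data.Nat.ListAction using (sum)
open import Data.Vec using (lookup)
open import Data.Product using (_×_)

-- A directed graph on vertex set V = Fin n, given by its (decidable)
-- adjacency relation: adj u v = true iff (u , v) is a directed edge.
-- Equivalently, the bipartite graph (V₁, V₂, E) with V₁ = V₂ = Fin n and
-- u ∈ V₁ adjacent to v ∈ V₂ iff adj u v = true.
DiGraph : ℕ → Set
DiGraph n = Fin n → Fin n → Bool

Σ[_] : ∀ {n} → (Fin n → ℕ) → ℕ
Σ[_] {n} f = sum (map f (allFin n))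

ind : Bool → ℕ
ind b = if b then 1 else 0

edges : ∀ {n} → DiGraph n → Subset n → Subset n → ℕ
edges G S T = Σ[ (λ u → Σ[ (λ v → ind (lookup S u ∧ lookup T v ∧ G u v)) ]) ]

-- degree in H = G[S ∪ T] of a vertex u ∈ V₁ (out-neighbours inside T)
degS : ∀ {n} → DiGraph n → Subset n → Fin n → ℕ
degS G T u = Σ[ (λ v → ind (lookup T v ∧ G u v)) ]

-- degree in H = G[S ∪ T] of a vertex v ∈ V₂ (in-neighbours inside S)
degT : ∀ {n} → DiGraph n → Subset n → Fin n → ℕ
degT G S v = Σ[ (λ u → ind (lookup S u ∧ G u v)) ]

-- ρ(S,T) ≤ ρ(S',T') where ρ(S,T) = |E(S,T)| / √(|S||T|), for nonempty sets.
-- Both sides are nonnegative, so this is equivalent to the squared,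
-- cross-multiplied comparison in ℕ:
--   |E(S,T)|² · |S'| |T'|  ≤  |E(S',T')|² · |S| |T| .
ρ≤ : ∀ {n} → DiGraph n → Subset n → Subset n → Subset n → Subset n → Set
ρ≤ G S T S' T' =
  edges G S T * edges G S T * (∣ S' ∣ * ∣ T' ∣)
    ≤ edges G S' T' * edges G S' T' * (∣ S ∣ * ∣ T ∣)

IsDensest : ∀ {n} → DiGraph n → Subset n → Subset n → Set
IsDensest G S* T* =
  Nonempty S* × Nonempty T* ×
  (∀ S T → Nonempty S → Nonempty T → ρ≤ G S T S* T*)

-- With D = ρ(S*,T*) and z = √(|S*|/|T*|) one has exactly
--   D/(2z) = |E(S*,T*)| / (2|S*|)   and   D z / 2 = |E(S*,T*)| / (2|T*|).
-- Hence d ≥ D/(2z)  ⇔  |E(S*,T*)| ≤ 2 |S*| d, and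
--       d ≥ D z / 2  ⇔  |E(S*,T*)| ≤ 2 |T*| d.
≥D/2z : ∀ {n} → DiGraph n → Subset n → Subset n → ℕ → Set
≥D/2z G S* T* d = edges G S* T* ≤ 2 * ∣ S* ∣ * d

≥Dz/2 : ∀ {n} → DiGraph n → Subset n → Subset n → ℕ → Set
≥Dz/2 G S* T* d = edges G S* T* ≤ 2 * ∣ T* ∣ * d

-- The densest pair (S*, T*) is itself the required subgraph. Let E = |E(S*,T*)| and
-- d = d_H(u) for u ∈ S*. Deleting u leaves E − d edges, so maximality of ρ gives
-- (E − d)² |S*| ≤ E² (|S*| − 1), i.e. E² ≤ |S*| d (2E − d) ≤ 2 |S*| d E; hence
-- E ≤ 2 |S*| d, which is d ≥ D/(2z). Reversing all edges swaps the roles of S* and T*.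
module Submission where

open import Defs
open import Algebra.Bundles using (CommutativeMonoid)
open import Data.Bool using (Bool; true; false; _∧_; if_then_else_)
open import Data.Bool.Properties using (∧-commutativeMonoid)
open import Data.Fin using (Fin; zero; suc)
open import Data.Fin.Subset using (Subset; Nonempty; Empty; _∈_; ∣_∣; _-_; ⊥)
open import Data.Fin.Subset.Properties using (nonempty?; Empty-unique; x∈p⇒∣p-x∣<∣p∣; p─⊥≡p)
open import Data.List using (tabulate)
open import Data.List.Properties using (map-tabulate)
open import Data.Nat using (ℕ; zero; suc; _+_; _*_; _≤_; _<_; z≤n; s≤s; NonZero; >-nonZero)
open import Data.Nat.ListAction using (sum)
open import Data.Nat.Properties
open import Data.Nat.Tactic.RingSolver using (solve-∀)
open import Data.Product using (Σ; _×_; _,_)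
open import Data.Vec using (_∷_; lookup; here; there)
open import Function using (_∘_; id; flip)
open import Relation.Binary.PropositionalEquality
open import Relation.Nullary using (yes; no)
open import Algebra.Properties.CommutativeMonoid.Sum +-0-commutativeMonoid using (sum-syntax; ∑-comm; sum-cong-≗; sum-replicate-zero)
open import Algebra.Properties.CommutativeSemigroup (CommutativeMonoid.commutativeSemigroup ∧-commutativeMonoid) using (x∙yz≈y∙xz)

sum-tabulate : ∀ {n} (f : Fin n → ℕ) → sum (tabulate f) ≡ ∑[ i < n ] f i
sum-tabulate {zero}  f = refl
sum-tabulate {suc n} f = cong (f zero +_) (sum-tabulate (f ∘ suc))

Σ≡∑ : ∀ {n} (f : Fin n → ℕ) → Σ[ f ] ≡ ∑[ i < n ] f i
Σ≡∑ f = trans (cong sum (map-tabulate id f)) (sum-tabulate f)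

∑-ind-∧ : ∀ {n} b (g : Fin n → Bool) →
  ∑[ i < n ] ind (b ∧ g i) ≡ (if b then ∑[ i < n ] ind (g i) else 0)
∑-ind-∧     true  g = refl
∑-ind-∧ {n} false g = sum-replicate-zero n

∑∈ : ∀ {n} → Subset n → (Fin n → ℕ) → ℕ
∑∈ {n} p f = ∑[ i < n ] (if lookup p i then f i else 0)

∑∈-cong : ∀ {n} (p : Subset n) {f g : Fin n → ℕ} → (∀ i → f i ≡ g i) → ∑∈ p f ≡ ∑∈ p g
∑∈-cong {n} p f≗g = sum-cong-≗ {n} (λ i → cong (λ x → if lookup p i then x else 0) (f≗g i))

∑∈-⊥ : ∀ {n} (f : Fin n → ℕ) → ∑∈ ⊥ f ≡ 0
∑∈-⊥ {zero}  f = refl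
∑∈-⊥ {suc n} f = ∑∈-⊥ (f ∘ suc)

∑∈-remove : ∀ {n} {p : Subset n} {x} (f : Fin n → ℕ) → x ∈ p → ∑∈ p f ≡ ∑∈ (p - x) f + f x
∑∈-remove {p = _ ∷ p} f here =
  trans (+-comm (f zero) _) (cong (λ q → ∑∈ q (f ∘ suc) + f zero) (sym (p─⊥≡p p)))
∑∈-remove {p = b ∷ p} f (there x∈p) =
  trans (cong ((if b then f zero else 0) +_) (∑∈-remove (f ∘ suc) x∈p))
        (sym (+-assoc (if b then f zero else 0) _ _))

edges≡∑∑ : ∀ {n} (G : DiGraph n) S T →
  edges G S T ≡ ∑[ u < n ] ∑[ v < n ] ind (lookup S u ∧ lookup T v ∧ G u v)
edges≡∑∑ {n} G S T =
  trans (Σ≡∑ (λ u → Σ[ (λ v → ind (lookup S u ∧ lookup T v ∧ G u v)) ]))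
        (sum-cong-≗ {n} (λ u → Σ≡∑ (λ v → ind (lookup S u ∧ lookup T v ∧ G u v))))

edges≡∑∈-degS : ∀ {n} (G : DiGraph n) S T → edges G S T ≡ ∑∈ S (degS G T)
edges≡∑∈-degS {n} G S T = begin
  edges G S T
    ≡⟨ edges≡∑∑ G S T ⟩
  ∑[ u < n ] ∑[ v < n ] ind (lookup S u ∧ lookup T v ∧ G u v)
    ≡⟨ sum-cong-≗ {n} (λ u → ∑-ind-∧ (lookup S u) (λ v → lookup T v ∧ G u v)) ⟩
  ∑∈ S (λ u → ∑[ v < n ] ind (lookup T v ∧ G u v))
    ≡⟨ ∑∈-cong S (λ u → sym (Σ≡∑ (λ v → ind (lookup T v ∧ G u v)))) ⟩
  ∑∈ S (degS G T) ∎
  where open ≡-Reasoning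

edges-flip : ∀ {n} (G : DiGraph n) S T → edges (flip G) T S ≡ edges G S T
edges-flip {n} G S T = begin
  edges (flip G) T S
    ≡⟨ edges≡∑∑ (flip G) T S ⟩
  ∑[ v < n ] ∑[ u < n ] ind (lookup T v ∧ lookup S u ∧ G u v)
    ≡⟨ sum-cong-≗ {n} (λ v → sum-cong-≗ {n} (λ u → cong ind (x∙yz≈y∙xz (lookup T v) (lookup S u) (G u v)))) ⟩
  ∑[ v < n ] ∑[ u < n ] ind (lookup S u ∧ lookup T v ∧ G u v)
    ≡⟨ ∑-comm (λ v u → ind (lookup S u ∧ lookup T v ∧ G u v)) ⟩
  ∑[ u < n ] ∑[ v < n ] ind (lookup S u ∧ lookup T v ∧ G u v)
    ≡⟨ edges≡∑∑ G S T ⟨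
  edges G S T ∎
  where open ≡-Reasoning

edges-removeˡ : ∀ {n} (G : DiGraph n) {S x} T → x ∈ S → edges G S T ≡ edges G (S - x) T + degS G T x
edges-removeˡ G {S} {x} T x∈S = begin
  edges G S T                        ≡⟨ edges≡∑∈-degS G S T ⟩
  ∑∈ S (degS G T)                    ≡⟨ ∑∈-remove (degS G T) x∈S ⟩
  ∑∈ (S - x) (degS G T) + degS G T x ≡⟨ cong (_+ degS G T x) (edges≡∑∈-degS G (S - x) T) ⟨
  edges G (S - x) T + degS G T x     ∎
  where open ≡-Reasoning

edges-emptyˡ : ∀ {n} (G : DiGraph n) S T → Empty S → edges G S T ≡ 0
edges-emptyˡ G S T S-empty = begin
  edges G S T     ≡⟨ edges≡∑∈-degS G S T ⟩
  ∑∈ S (degS G T) ≡⟨ cong (λ S → ∑∈ S (degS G T)) (Empty-unique S-empty) ⟩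
  ∑∈ ⊥ (degS G T) ≡⟨ ∑∈-⊥ (degS G T) ⟩
  0               ∎
  where open ≡-Reasoning

edges-emptyʳ : ∀ {n} (G : DiGraph n) S T → Empty T → edges G S T ≡ 0
edges-emptyʳ G S T T-empty = trans (sym (edges-flip G S T)) (edges-emptyˡ (flip G) T S T-empty)

ρ≤-edgeless : ∀ {n} (G : DiGraph n) S T S' T' → edges G S T ≡ 0 → ρ≤ G S T S' T'
ρ≤-edgeless G S T S' T' e≡0 =
  subst (λ e → e * e * (∣ S' ∣ * ∣ T' ∣) ≤ edges G S' T' * edges G S' T' * (∣ S ∣ * ∣ T ∣))
        (sym e≡0) z≤n

densest⇒ρ≤ : ∀ {n} (G : DiGraph n) {S* T*} → IsDensest G S* T* → ∀ S T → ρ≤ G S T S* T*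
densest⇒ρ≤ G {S*} {T*} (_ , _ , maximal) S T with nonempty? S | nonempty? T
... | yes S≠∅ | yes T≠∅ = maximal S T S≠∅ T≠∅
... | no  S=∅ | _       = ρ≤-edgeless G S T S* T* (edges-emptyˡ G S T S=∅)
... | yes _   | no  T=∅ = ρ≤-edgeless G S T S* T* (edges-emptyʳ G S T T=∅)

ρ≤-flip : ∀ {n} (G : DiGraph n) {S T S' T'} → ρ≤ G S T S' T' → ρ≤ (flip G) T S T' S'
ρ≤-flip G {S} {T} {S'} {T'} =
  subst₂ _≤_ (cong₂ (λ e c → e * e * c) (sym (edges-flip G S T)) (*-comm ∣ S' ∣ ∣ T' ∣))
             (cong₂ (λ e c → e * e * c) (sym (edges-flip G S' T')) (*-comm ∣ S ∣ ∣ T ∣))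

IsDensest-flip : ∀ {n} (G : DiGraph n) {S* T*} → IsDensest G S* T* → IsDensest (flip G) T* S*
IsDensest-flip G {S*} {T*} (S*≠∅ , T*≠∅ , maximal) =
  T*≠∅ , S*≠∅ , λ T S T≠∅ S≠∅ → ρ≤-flip G {S} {T} {S*} {T*} (maximal S T S≠∅ T≠∅)

m*m≤n*m⇒m≤n : ∀ m n → m * m ≤ n * m → m ≤ n
m*m≤n*m⇒m≤n zero      n _  = z≤n
m*m≤n*m⇒m≤n m@(suc _) n le = *-cancelʳ-≤ m n m le

sq-drop⇒≤ : ∀ e d k → e * e * suc k ≤ (e + d) * (e + d) * k → e + d ≤ 2 * suc k * d
sq-drop⇒≤ e d k drop = m*m≤n*m⇒m≤n E (2 * s * d) (+-cancelˡ-≤ (e * e * s) _ _ (begin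
  e * e * s + E * E              ≤⟨ +-monoˡ-≤ (E * E) drop ⟩
  E * E * k + E * E              ≤⟨ m≤m+n _ (d * d * s) ⟩
  E * E * k + E * E + d * d * s  ≡⟨ identity e d k ⟩
  e * e * s + 2 * s * d * E      ∎))
  where
  open ≤-Reasoning
  s = suc k
  E = e + d
  identity : ∀ e d k → (e + d) * (e + d) * k + (e + d) * (e + d) + d * d * suc k
                       ≡ e * e * suc k + 2 * suc k * d * (e + d)
  identity = solve-∀

ρ-drop⇒≤ : ∀ {e d E a s} c .{{_ : NonZero c}} → E ≡ e + d → a < s →
  e * e * (s * c) ≤ E * E * (a * c) → E ≤ 2 * s * d
ρ-drop⇒≤ {e} {d} {E} {a} {suc k} c refl (s≤s a≤k) ρ-drop = sq-drop⇒≤ e d k (begin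
  e * e * suc k  ≤⟨ *-cancelʳ-≤ _ _ c reassociated ⟩
  E * E * a      ≤⟨ *-monoʳ-≤ (E * E) a≤k ⟩
  E * E * k      ∎)
  where
  open ≤-Reasoning
  reassociated : e * e * suc k * c ≤ E * E * a * c
  reassociated = subst₂ _≤_ (sym (*-assoc (e * e) (suc k) c)) (sym (*-assoc (E * E) a c)) ρ-drop

∣p∣-nonZero : ∀ {n} {p : Subset n} {x} → x ∈ p → NonZero ∣ p ∣
∣p∣-nonZero x∈p = >-nonZero (≤-<-trans z≤n (x∈p⇒∣p-x∣<∣p∣ x∈p))

degS-bound : ∀ {n} (G : DiGraph n) {S* T* u} → IsDensest G S* T* → u ∈ S* →
  edges G S* T* ≤ 2 * ∣ S* ∣ * degS G T* u
degS-bound G {S*} {T*} {u} densest@(_ , (_ , t∈T*) , _) u∈S* =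
  ρ-drop⇒≤ ∣ T* ∣ {{∣p∣-nonZero t∈T*}} (edges-removeˡ G T* u∈S*)
    (x∈p⇒∣p-x∣<∣p∣ u∈S*) (densest⇒ρ≤ G densest (S* - u) T*)

mainTheorem3 : ∀ {n} (G : DiGraph n) (S* T* : Subset n) → IsDensest G S* T* →
    Σ (Subset n) λ S → Σ (Subset n) λ T →
      Nonempty S × Nonempty T ×
      (∀ v → v ∈ S → ≥D/2z G S* T* (degS G T v)) ×
      (∀ v → v ∈ T → ≥Dz/2 G S* T* (degT G S v))
mainTheorem3 G S* T* densest@(S*≠∅ , T*≠∅ , _) =
  S* , T* , S*≠∅ , T*≠∅ , (λ u → degS-bound G densest) , degT-bound
  where
  degT-bound : ∀ v → v ∈ T* → ≥Dz/2 G S* T* (degT G S* v)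
  -- Out-degrees of the reversed graph into S* are the in-degrees degT G S*.
  degT-bound v v∈T* = subst (_≤ 2 * ∣ T* ∣ * degT G S* v) (edges-flip G S* T*)
    (degS-bound (flip G) (IsDensest-flip G densest) v∈T*)
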